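{- Let $G$ be a graph isomorphic to $F^d$ for some graph $F$ and some integer $d\ge 2$. Then $\eta(G)\ge\chi(G)$ (i.e., Hadwiger's conjecture is true for $G$).
   Context: All graphs are finite, simple and undirected; $\chi$ is the chromatic number. The Cartesian product $G_1 \,\Box\, G_2$ has vertex set $V(G_1)\times V(G_2)$, and $(u,v)$ is adjacent to $(u',v')$ iff either $v=v'$ and $uu'\in E(G_1)$, or $u=u'$ and $vv'\in E(G_2)$. $F^d$ denotes the Cartesian product of $d$ copies of $F$. A graph $M$ is a minor of $G$ if it can be obtained from $G$ by deleting vertices and edges and contracting edges. The Hadwiger number $\eta(G)$ is the largest $n$ such that the complete graph $K_n$ is a minor of $G$. -}

module Defs where

open import Data.Nat using (ℕ; zero; suc; _*_; _≤_; pred)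
open import Data.Fin using (Fin; zero; suc; punchIn; remQuot; _≟_)
open import Data.Product using (Σ; _×_; _,_; proj₁; proj₂)
open import Data.Sum using (_⊎_; inj₁; inj₂)
open import Data.Empty using (⊥)
open import Relation.Nullary using (¬_; Dec; yes; no)
open import Relation.Nullary.Decidable using (_×-dec_; _⊎-dec_; ¬?)
open import Relation.Binary.PropositionalEquality using (_≡_; _≢_; refl; sym)
open import Function.Bundles using (_↔_; _⇔_; Inverse)

record Graph : Set₁ where
  field
    n      : ℕ
    Adj    : Fin n → Fin n → Set
    adj?   : ∀ x y → Dec (Adj x y)
    adj-sym : ∀ {x y} → Adj x y → Adj y x
    irrefl : ∀ {x} → ¬ Adj x x

open Graph public

record _≅_ (G H : Graph) : Set where
  field
    bij      : Fin (n G) ↔ Fin (n H)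
    preserve : ∀ x y → Adj G x y ⇔ Adj H (Inverse.to bij x) (Inverse.to bij y)

K : ℕ → Graph
K k = record
  { n = k
  ; Adj = λ i j → i ≢ j
  ; adj? = λ i j → ¬? (i ≟ j)
  ; adj-sym = λ p q → p (sym q)
  ; irrefl = λ p → p refl
  }

_□_ : Graph → Graph → Graph
G₁ □ G₂ = record
  { n = n G₁ * n G₂
  ; Adj = A
  ; adj? = λ i j → ((proj₂ (rq i) ≟ proj₂ (rq j)) ×-dec adj? G₁ (proj₁ (rq i)) (proj₁ (rq j)))
                   ⊎-dec ((proj₁ (rq i) ≟ proj₁ (rq j)) ×-dec adj? G₂ (proj₂ (rq i)) (proj₂ (rq j)))
  ; adj-sym = λ { (inj₁ (e , a)) → inj₁ (sym e , Graph.adj-sym G₁ a)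
            ; (inj₂ (e , a)) → inj₂ (sym e , Graph.adj-sym G₂ a) }
  ; irrefl = λ { (inj₁ (_ , a)) → irrefl G₁ a ; (inj₂ (_ , a)) → irrefl G₂ a }
  }
  where
  rq : Fin (n G₁ * n G₂) → Fin (n G₁) × Fin (n G₂)
  rq = remQuot (n G₂)
  A : Fin (n G₁ * n G₂) → Fin (n G₁ * n G₂) → Set
  A i j = (proj₂ (rq i) ≡ proj₂ (rq j) × Adj G₁ (proj₁ (rq i)) (proj₁ (rq j)))
        ⊎ (proj₁ (rq i) ≡ proj₁ (rq j) × Adj G₂ (proj₂ (rq i)) (proj₂ (rq j)))

_^□_ : Graph → ℕ → Graph
F ^□ zero = K 1
F ^□ suc zero = F
F ^□ suc (suc d) = F □ (F ^□ suc d)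

skip : ∀ {m} → Fin m → Fin (pred m) → Fin m
skip {suc m} v i = punchIn v i

deleteVertex : (G : Graph) → Fin (n G) → Graph
deleteVertex G v = record
  { n = pred (n G)
  ; Adj = λ i j → Adj G (skip v i) (skip v j)
  ; adj? = λ i j → adj? G (skip v i) (skip v j)
  ; adj-sym = Graph.adj-sym G
  ; irrefl = irrefl G
  }

-- Deleting the edge uv (no-op if uv is not an edge).
deleteEdge : (G : Graph) → Fin (n G) → Fin (n G) → Graph
deleteEdge G u v = record
  { n = n G
  ; Adj = A
  ; adj? = λ x y → adj? G x y ×-dec ¬? (((x ≟ u) ×-dec (y ≟ v)) ⊎-dec ((x ≟ v) ×-dec (y ≟ u)))
  ; adj-sym = λ { (a , f) → Graph.adj-sym G a , λ { (inj₁ (p , q)) → f (inj₂ (q , p))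
                                          ; (inj₂ (p , q)) → f (inj₁ (q , p)) } }
  ; irrefl = λ p → irrefl G (proj₁ p)
  }
  where
  A : Fin (n G) → Fin (n G) → Set
  A x y = Adj G x y × ¬ ((x ≡ u × y ≡ v) ⊎ (x ≡ v × y ≡ u))

-- Contracting the edge uv: v is merged into u (v is removed, u inherits v's neighbours).
contract : (G : Graph) → Fin (n G) → Fin (n G) → Graph
contract G u v = record
  { n = pred (n G)
  ; Adj = A
  ; adj? = λ i j → ((adj? G (skip v i) (skip v j)
                    ⊎-dec ((skip v i ≟ u) ×-dec adj? G v (skip v j)))
                    ⊎-dec ((skip v j ≟ u) ×-dec adj? G (skip v i) v))
                   ×-dec ¬? (i ≟ j)
  ; adj-sym = λ { (inj₁ (inj₁ a) , ne) → inj₁ (inj₁ (Graph.adj-sym G a)) , λ e → ne (sym e)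
            ; (inj₁ (inj₂ (e , a)) , ne) → inj₂ (e , Graph.adj-sym G a) , λ e → ne (sym e)
            ; (inj₂ (e , a) , ne) → inj₁ (inj₂ (e , Graph.adj-sym G a)) , λ e → ne (sym e) }
  ; irrefl = λ p → proj₂ p refl
  }
  where
  A : Fin (pred (n G)) → Fin (pred (n G)) → Set
  A i j = ((Adj G (skip v i) (skip v j)
           ⊎ (skip v i ≡ u × Adj G v (skip v j)))
           ⊎ (skip v j ≡ u × Adj G (skip v i) v))
          × i ≢ j

data _≼_ (M : Graph) : Graph → Set₁ where
  iso      : ∀ {G} → M ≅ G → M ≼ G
  delV     : ∀ {G} (v : Fin (n G)) → M ≼ deleteVertex G v → M ≼ G
  delE     : ∀ {G} (u v : Fin (n G)) → M ≼ deleteEdge G u v → M ≼ G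
  contrE   : ∀ {G} (u v : Fin (n G)) → Adj G u v → M ≼ contract G u v → M ≼ G

Colorable : Graph → ℕ → Set
Colorable G k = Σ (Fin (n G) → Fin k) λ c → ∀ x y → Adj G x y → c x ≢ c y

IsChromaticNumber : Graph → ℕ → Set
IsChromaticNumber G k = Colorable G k × (∀ j → Colorable G j → k ≤ j)

IsHadwigerNumber : Graph → ℕ → Set₁
IsHadwigerNumber G h = (K h ≼ G) × (∀ j → K j ≼ G → j ≤ h)

-- Choose m so that F has a vertex of degree at least m and is (m + 1)-colourable; greedy
-- colouring finds one, since whenever m + 1 colours do not suffice it exhibits a vertex with
-- m + 1 neighbours of distinct colours.  Colouring a vertex of F □ F^(d-1) by the sum of the
-- colours of its two coordinates modulo m + 1 is proper, so χ(G) ≤ m + 1.  On the other hand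
-- the product of two stars with m leaves has a K_(m+1) minor: one branch set is the pair of
-- centres, and branch set i is the hook of leaf pairs (i′ , j′) with max i′ j′ = i, together
-- with (centre , leaf i) and (leaf i , centre).  Hence χ(G) ≤ m + 1 ≤ η(G).
module Submission where

open import Defs
open import Data.Bool using (if_then_else_)
open import Data.Empty using (⊥-elim)
open import Data.Fin as Fin using (Fin; zero; suc; toℕ; fromℕ<; inject≤; punchOut; remQuot; combine; _≟_)
import Data.Fin.Properties as Fin
open import Data.Maybe using (Maybe; just; nothing)
open import Data.Maybe.Properties using (just-injective)
open import Data.Nat using (ℕ; zero; suc; pred; _+_; _∸_; _%_; _≤_; _<_; z≤n; s≤s)
open import Data.Nat.DivMod using (_mod_; %-distribˡ-+; m%n%n≡m%n; [m+n]%n≡m%n; m<n⇒m%n≡m; m%n<n)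
open import Data.Nat.Properties
  using (≤-refl; ≤-reflexive; ≤-trans; ≤-<-trans; <⇒≤; <-irrefl; ≤∧≢⇒<; ≤-pred; n≤1+n; _<?_; +-assoc; +-comm; +-suc; +-identityʳ; m+[n∸m]≡n)
open import Data.Product using (Σ; ∃; ∃-syntax; ∃₂; _×_; _,_; proj₁; proj₂)
open import Data.Sum using (_⊎_; inj₁; inj₂)
open import Function using (_∘_; id)
open import Function.Bundles using (Inverse; Equivalence; _↔_; mk↔ₛ′; mk⇔)
open import Function.Definitions using (Injective)
open import Relation.Binary using (tri<; tri≈; tri>)
open import Relation.Binary.PropositionalEquality
open import Relation.Nullary using (¬_; Dec; yes; no; contradiction)
open import Relation.Nullary.Decidable using (⌊_⌋; _×-dec_)

-- Clique minors from branch-set models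

skip-injective : ∀ {m} (v : Fin m) {i j} → skip v i ≡ skip v j → i ≡ j
skip-injective {suc m} v = Fin.punchIn-injective v _ _

skip≢ : ∀ {m} (v : Fin m) i → skip v i ≢ v
skip≢ {suc m} v = Fin.punchInᵢ≢i v

unskip : ∀ {m} (v y : Fin m) → y ≢ v → Fin (pred m)
unskip {suc m} v y y≢v = punchOut (≢-sym y≢v)

skip-unskip : ∀ {m} (v y : Fin m) (y≢v : y ≢ v) → skip v (unskip v y y≢v) ≡ y
skip-unskip {suc m} v y y≢v = Fin.punchIn-punchOut (≢-sym y≢v)

unskip-skip : ∀ {m} (v : Fin m) i (i≢v : skip v i ≢ v) → unskip v (skip v i) i≢v ≡ i
unskip-skip {suc m} v i i≢v = trans (Fin.punchOut-cong v refl) (Fin.punchOut-punchIn v)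

data Skipped {m} (v : Fin m) : Fin m → Set where
  skipped : ∀ i → Skipped v (skip v i)

skipped? : ∀ {m} {v y : Fin m} → y ≢ v → Skipped v y
skipped? {v = v} {y} y≢v = subst (Skipped v) (skip-unskip v y y≢v) (skipped _)

-- A model of K_m: the branch sets are the fibres of `branch`; every non-root vertex of a branch set
-- has a neighbour in it of smaller height, so each branch set is connected.
record CliqueModel (m : ℕ) {V : Set} (E : V → V → Set) : Set where
  field
    branch      : V → Maybe (Fin m)
    root        : Fin m → V
    branch-root : ∀ i → branch (root i) ≡ just i
    height      : V → ℕ
    descend     : ∀ {z i} → branch z ≡ just i → z ≢ root i →
                  ∃[ p ] E z p × branch p ≡ just i × height p < height z
    touch       : ∀ {i j} → i ≢ j →
                  ∃₂ λ a b → branch a ≡ just i × branch b ≡ just j × E a b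

  branch-distinct : ∀ {a b i j} → branch a ≡ just i → branch b ≡ just j → i ≢ j → a ≢ b
  branch-distinct a∈i b∈j i≢j refl = i≢j (just-injective (trans (sym a∈i) b∈j))

↔-cliqueModel : ∀ {m} {V W : Set} {E : V → V → Set} {E′ : W → W → Set} (φ : V ↔ W) →
            (∀ {a b} → E′ (Inverse.to φ a) (Inverse.to φ b) → E a b) →
            CliqueModel m E′ → CliqueModel m E
↔-cliqueModel {E = E} {E′} φ reflect M = record
  { branch      = M.branch ∘ to
  ; root        = from ∘ M.root
  ; branch-root = λ i → trans (cong M.branch (to-from (M.root i))) (M.branch-root i)
  ; height      = M.height ∘ to
  ; descend     = descend′
  ; touch       = touch′
  }
  where
  module M = CliqueModel M
  open Inverse φ using (to; from)
  to-from = Inverse.strictlyInverseˡ φ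
  from-to = Inverse.strictlyInverseʳ φ
  reflect′ : ∀ {a b} → E′ a b → E (from a) (from b)
  reflect′ {a} {b} e = reflect (subst₂ E′ (sym (to-from a)) (sym (to-from b)) e)
  descend′ : ∀ {z i} → M.branch (to z) ≡ just i → z ≢ from (M.root i) →
             ∃[ p ] E z p × M.branch (to p) ≡ just i × M.height (to p) < M.height (to z)
  descend′ {z} z∈i z≢root with M.descend z∈i (λ e → z≢root (trans (sym (from-to z)) (cong from e)))
  ... | p , zp , p∈i , hp = from p , subst (λ q → E q (from p)) (from-to z) (reflect′ zp) ,
                             trans (cong M.branch (to-from p)) p∈i ,
                             subst (λ q → M.height q < M.height (to z)) (sym (to-from p)) hp
  touch′ : ∀ {i j} → i ≢ j → ∃₂ λ a b → M.branch (to a) ≡ just i × M.branch (to b) ≡ just j × E a b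
  touch′ i≢j with M.touch i≢j
  ... | a , b , a∈i , b∈j , ab = from a , from b , trans (cong M.branch (to-from a)) a∈i ,
                                 trans (cong M.branch (to-from b)) b∈j , reflect′ ab

module _ {m} {G : Graph} (M : CliqueModel m (Adj G)) where
  open CliqueModel M

  deleteVertex-model : ∀ v → branch v ≡ nothing → CliqueModel m (Adj (deleteVertex G v))
  deleteVertex-model v v∉ = record
    { branch      = branch ∘ skip v
    ; root        = λ i → unskip v (root i) (branched≢v (branch-root i))
    ; branch-root = λ i → trans (cong branch (skip-unskip v _ _)) (branch-root i)
    ; height      = height ∘ skip v
    ; descend     = descend′
    ; touch       = touch′
    }
    where
    branched≢v : ∀ {y i} → branch y ≡ just i → y ≢ v
    branched≢v y∈i refl with () ← trans (sym y∈i) v∉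
    descend′ : ∀ {z i} → branch (skip v z) ≡ just i → z ≢ unskip v (root i) _ →
               ∃[ p ] Adj G (skip v z) (skip v p) × branch (skip v p) ≡ just i × height (skip v p) < height (skip v z)
    descend′ {z} z∈i z≢root with descend z∈i (λ e → z≢root (skip-injective v (trans e (sym (skip-unskip v _ _)))))
    ... | p , zp , p∈i , hp with skipped? (branched≢v p∈i)
    ... | skipped p′ = p′ , zp , p∈i , hp
    touch′ : ∀ {i j} → i ≢ j → ∃₂ λ a b → branch (skip v a) ≡ just i × branch (skip v b) ≡ just j × Adj G (skip v a) (skip v b)
    touch′ i≢j with touch i≢j
    ... | a , b , a∈i , b∈j , ab with skipped? (branched≢v a∈i) | skipped? (branched≢v b∈j)
    ... | skipped a′ | skipped b′ = a′ , b′ , a∈i , b∈j , ab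

  module Contraction {x i₀} (x∈i₀ : branch x ≡ just i₀) (x≢root : x ≢ root i₀) where

    parent : Fin (n G)
    parent = proj₁ (descend x∈i₀ x≢root)

    x-parent : Adj G x parent
    x-parent = proj₁ (proj₂ (descend x∈i₀ x≢root))

    private
      parent∈i₀ : branch parent ≡ just i₀
      parent∈i₀ = proj₁ (proj₂ (proj₂ (descend x∈i₀ x≢root)))

      parent-lower : height parent < height x
      parent-lower = proj₂ (proj₂ (proj₂ (descend x∈i₀ x≢root)))

      parent≢x : parent ≢ x
      parent≢x e = irrefl G (subst (Adj G x) e x-parent)

    merge : Fin (n G) → Fin (pred (n G))
    merge y with y ≟ x
    ... | yes _   = unskip x parent parent≢x
    ... | no  y≢x = unskip x y y≢x

    merge-skip : ∀ z → merge (skip x z) ≡ z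
    merge-skip z with skip x z ≟ x
    ... | yes z≡x = contradiction z≡x (skip≢ x z)
    ... | no  z≢x = unskip-skip x z z≢x

    skip-merge : ∀ y → skip x (merge y) ≡ y ⊎ (y ≡ x × skip x (merge y) ≡ parent)
    skip-merge y with y ≟ x
    ... | yes y≡x = inj₂ (y≡x , skip-unskip x parent parent≢x)
    ... | no  y≢x = inj₁ (skip-unskip x y y≢x)

    branch-merge : ∀ y → branch (skip x (merge y)) ≡ branch y
    branch-merge y with skip-merge y
    ... | inj₁ e          = cong branch e
    ... | inj₂ (refl , e) = trans (cong branch e) (trans parent∈i₀ (sym x∈i₀))

    height-merge : ∀ y → height (skip x (merge y)) ≤ height y
    height-merge y with skip-merge y
    ... | inj₁ e          = ≤-reflexive (cong height e)
    ... | inj₂ (refl , e) = ≤-trans (≤-reflexive (cong height e)) (<⇒≤ parent-lower)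

    merge-adj : ∀ {a b} → Adj G a b → merge a ≢ merge b → Adj (contract G parent x) (merge a) (merge b)
    merge-adj {a} {b} ab ne with skip-merge a | skip-merge b
    ... | inj₁ ea          | inj₁ eb          = inj₁ (inj₁ (subst₂ (Adj G) (sym ea) (sym eb) ab)) , ne
    ... | inj₂ (refl , ea) | inj₁ eb          = inj₁ (inj₂ (ea , subst (Adj G x) (sym eb) ab)) , ne
    ... | inj₁ ea          | inj₂ (refl , eb) = inj₂ (eb , subst (λ q → Adj G q x) (sym ea) ab) , ne
    ... | inj₂ (refl , _)  | inj₂ (refl , _)  = contradiction ab (irrefl G)

    contract-model : CliqueModel m (Adj (contract G parent x))
    contract-model = record
      { branch      = branch ∘ skip x
      ; root        = merge ∘ root
      ; branch-root = λ i → trans (branch-merge (root i)) (branch-root i)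
      ; height      = height ∘ skip x
      ; descend     = descend′
      ; touch       = touch′
      }
      where
      descend′ : ∀ {z i} → branch (skip x z) ≡ just i → z ≢ merge (root i) →
                 ∃[ p ] Adj (contract G parent x) z p × branch (skip x p) ≡ just i × height (skip x p) < height (skip x z)
      descend′ {z} z∈i z≢root with descend z∈i (λ e → z≢root (trans (sym (merge-skip z)) (cong merge e)))
      ... | p , zp , p∈i , hp = merge p , subst (λ q → Adj (contract G parent x) q (merge p)) (merge-skip z) (merge-adj zp z≢p) ,
                                trans (branch-merge p) p∈i , lower
        where
        lower : height (skip x (merge p)) < height (skip x z)
        lower = ≤-<-trans (height-merge p) hp
        z≢p : merge (skip x z) ≢ merge p
        z≢p e = <-irrefl (cong (height ∘ skip x) (trans (sym e) (merge-skip z))) lower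
      touch′ : ∀ {i j} → i ≢ j → ∃₂ λ a b → branch (skip x a) ≡ just i × branch (skip x b) ≡ just j × Adj (contract G parent x) a b
      touch′ i≢j with touch i≢j
      ... | a , b , a∈i , b∈j , ab = merge a , merge b , a∈i′ , b∈j′ , merge-adj ab (branch-distinct a∈i′ b∈j′ i≢j ∘ cong (skip x))
        where
        a∈i′ = trans (branch-merge a) a∈i
        b∈j′ = trans (branch-merge b) b∈j

  NonRoot : Fin (n G) → Set
  NonRoot z = ∃[ i ] branch z ≡ just i × z ≢ root i

  nonRoot? : ∀ z → Dec (NonRoot z)
  nonRoot? z with branch z
  ... | nothing = no λ { (_ , () , _) }
  ... | just i with z ≟ root i
  ...   | yes z≡root = no λ { (_ , refl , z≢root) → z≢root z≡root }
  ...   | no  z≢root = yes (i , refl , z≢root)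

  unbranched? : ∀ z → Dec (branch z ≡ nothing)
  unbranched? z with branch z
  ... | nothing = yes refl
  ... | just _  = no λ ()

  roots-only⇒K≅ : ¬ (∃[ v ] branch v ≡ nothing) → ¬ (∃ NonRoot) → K m ≅ G
  roots-only⇒K≅ no-unbranched no-nonRoot = record
    { bij = mk↔ₛ′ root (proj₁ ∘ branched) (λ z → sym (is-root (proj₂ (branched z)))) from-root
    ; preserve = λ i j → mk⇔ (root-adj i j) λ { adj refl → irrefl G adj }
    }
    where
    branched : ∀ z → ∃[ i ] branch z ≡ just i
    branched z with branch z in z∈
    ... | just i  = i , refl
    ... | nothing = contradiction (z , z∈) no-unbranched
    is-root : ∀ {z i} → branch z ≡ just i → z ≡ root i
    is-root {z} {i} z∈i with z ≟ root i
    ... | yes z≡root = z≡root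
    ... | no  z≢root = contradiction (z , i , z∈i , z≢root) no-nonRoot
    from-root : ∀ i → proj₁ (branched (root i)) ≡ i
    from-root i = just-injective (trans (sym (proj₂ (branched (root i)))) (branch-root i))
    root-adj : ∀ i j → i ≢ j → Adj G (root i) (root j)
    root-adj i j i≢j with touch i≢j
    ... | a , b , a∈i , b∈j , ab = subst₂ (Adj G) (is-root a∈i) (is-root b∈j) ab

-- Delete an unbranched vertex or contract a non-root vertex into its parent, until only the roots remain.
cliqueModel⇒minor′ : ∀ {m} k {G : Graph} → n G ≡ k → CliqueModel m (Adj G) → K m ≼ G
cliqueModel⇒minor′ k {G} eq M with Fin.any? (unbranched? {G = G} M) | Fin.any? (nonRoot? {G = G} M)
cliqueModel⇒minor′ zero    eq M | yes (v , _) | _ = contradiction (subst Fin eq v) Fin.¬Fin0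
cliqueModel⇒minor′ (suc k) {G} eq M | yes (v , v∉) | _ =
  delV v (cliqueModel⇒minor′ k (cong pred eq) (deleteVertex-model {G = G} M v v∉))
cliqueModel⇒minor′ zero    eq M | no _ | yes (x , _) = contradiction (subst Fin eq x) Fin.¬Fin0
cliqueModel⇒minor′ (suc k) {G} eq M | no _ | yes (x , i , x∈i , x≢root) =
  contrE parent x (adj-sym G x-parent) (cliqueModel⇒minor′ k (cong pred eq) contract-model)
  where open Contraction {G = G} M x∈i x≢root
cliqueModel⇒minor′ k {G} eq M | no no-unbranched | no no-nonRoot = iso (roots-only⇒K≅ {G = G} M no-unbranched no-nonRoot)

cliqueModel⇒minor : ∀ {m} {G : Graph} → CliqueModel m (Adj G) → K m ≼ G
cliqueModel⇒minor {G = G} = cliqueModel⇒minor′ (n G) refl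

≅-cliqueModel : ∀ {m} {G H : Graph} → G ≅ H → CliqueModel m (Adj H) → CliqueModel m (Adj G)
≅-cliqueModel G≅H = ↔-cliqueModel (_≅_.bij G≅H) (λ {a} {b} → Equivalence.from (_≅_.preserve G≅H a b))

-- Colourings and stars

colorable-≅ : ∀ {G H k} → G ≅ H → Colorable H k → Colorable G k
colorable-≅ G≅H (c , proper) = c ∘ Inverse.to (_≅_.bij G≅H) ,
  λ x y adj → proper _ _ (Equivalence.to (_≅_.preserve G≅H x y) adj)

colorable-empty : ∀ {G} → ¬ Fin (n G) → Colorable G 0
colorable-empty none = ⊥-elim ∘ none , λ x → ⊥-elim (none x)

colorable-self : ∀ G → Colorable G (n G)
colorable-self G = id , λ x y adj x≡y → irrefl G (subst (Adj G x) (sym x≡y) adj)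

colorable-mono : ∀ {G k k′} → k ≤ k′ → Colorable G k → Colorable G k′
colorable-mono k≤k′ (c , proper) = (λ x → inject≤ (c x) k≤k′) ,
  λ x y adj e → proper x y adj (Fin.inject≤-injective _ _ _ _ e)

infixl 6 _⊕_

_⊕_ : ∀ {k} → Fin (suc k) → Fin (suc k) → Fin (suc k)
_⊕_ {k} a b = (toℕ a + toℕ b) mod suc k

⊕-comm : ∀ {k} (a b : Fin (suc k)) → a ⊕ b ≡ b ⊕ a
⊕-comm {k} a b = cong (_mod suc k) (+-comm (toℕ a) (toℕ b))

⊕-undo : ∀ {k} (a b : Fin (suc k)) → (toℕ (a ⊕ b) + (suc k ∸ toℕ b)) % suc k ≡ toℕ a
⊕-undo {k} a b = begin
  (toℕ (a ⊕ b) + (q ∸ β)) % q         ≡⟨ cong (λ t → (t + (q ∸ β)) % q) (Fin.toℕ-fromℕ< (m%n<n (α + β) q)) ⟩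
  ((α + β) % q + (q ∸ β)) % q         ≡⟨ %-distribˡ-+ ((α + β) % q) (q ∸ β) q ⟩
  ((α + β) % q % q + (q ∸ β) % q) % q ≡⟨ cong (λ t → (t + (q ∸ β) % q) % q) (m%n%n≡m%n (α + β) q) ⟩
  ((α + β) % q + (q ∸ β) % q) % q     ≡⟨ %-distribˡ-+ (α + β) (q ∸ β) q ⟨
  (α + β + (q ∸ β)) % q               ≡⟨ cong (_% q) (+-assoc α β (q ∸ β)) ⟩
  (α + (β + (q ∸ β))) % q             ≡⟨ cong (λ t → (α + t) % q) (m+[n∸m]≡n (<⇒≤ (Fin.toℕ<n b))) ⟩
  (α + q) % q                         ≡⟨ [m+n]%n≡m%n α q ⟩
  α % q                               ≡⟨ m<n⇒m%n≡m (Fin.toℕ<n a) ⟩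
  α                                   ∎
  where
  open ≡-Reasoning
  q = suc k
  α = toℕ a
  β = toℕ b

⊕-cancelʳ : ∀ {k} {a a′ : Fin (suc k)} b → a ⊕ b ≡ a′ ⊕ b → a ≡ a′
⊕-cancelʳ {k} {a} {a′} b e = Fin.toℕ-injective
  (trans (sym (⊕-undo a b)) (trans (cong (λ t → (toℕ t + (suc k ∸ toℕ b)) % suc k) e) (⊕-undo a′ b)))

⊕-cancelˡ : ∀ {k} a {b b′ : Fin (suc k)} → a ⊕ b ≡ a ⊕ b′ → b ≡ b′
⊕-cancelˡ a {b} {b′} e = ⊕-cancelʳ a (trans (⊕-comm b a) (trans e (⊕-comm a b′)))

-- Adj (A □ B) z w unfolds to Adj₂ A B (remQuot (n B) z) (remQuot (n B) w).
Adj₂ : (A B : Graph) → Fin (n A) × Fin (n B) → Fin (n A) × Fin (n B) → Set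
Adj₂ A B (x , y) (x′ , y′) = (y ≡ y′ × Adj A x x′) ⊎ (x ≡ x′ × Adj B y y′)

□-adj : ∀ {A B x y x′ y′} → Adj₂ A B (x , y) (x′ , y′) → Adj (A □ B) (combine x y) (combine x′ y′)
□-adj {A} {B} {x} {y} {x′} {y′} = subst₂ (Adj₂ A B) (sym (Fin.remQuot-combine x y)) (sym (Fin.remQuot-combine x′ y′))

□-colorable : ∀ {A B k} → Colorable A (suc k) → Colorable B (suc k) → Colorable (A □ B) (suc k)
□-colorable {A} {B} (c , c-proper) (d , d-proper) = color ∘ remQuot {n A} (n B) , λ _ _ → proper
  where
  color : Fin (n A) × Fin (n B) → Fin _
  color (x , y) = c x ⊕ d y
  proper : ∀ {p q} → Adj₂ A B p q → color p ≢ color q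
  proper {x , y} {x′ , _} (inj₁ (refl , adj)) e = c-proper x x′ adj (⊕-cancelʳ (d y) e)
  proper {x , y} {_ , y′} (inj₂ (refl , adj)) e = d-proper y y′ adj (⊕-cancelˡ (c x) e)

^□-colorable : ∀ {F k} e → Colorable F (suc k) → Colorable (F ^□ suc e) (suc k)
^□-colorable zero    C = C
^□-colorable {F} (suc e) C = □-colorable {F} {F ^□ suc e} C (^□-colorable e C)

record Star (G : Graph) (m : ℕ) : Set where
  field
    centre         : Fin (n G)
    leaf           : Fin m → Fin (n G)
    leaf-injective : Injective _≡_ _≡_ leaf
    centre-leaf    : ∀ i → Adj G centre (leaf i)

  leaf≢centre : ∀ i → leaf i ≢ centre
  leaf≢centre i e = irrefl G (subst (Adj G centre) e (centre-leaf i))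

module _ (G : Graph) where

  PrefixColoring : ℕ → ℕ → Set
  PrefixColoring k t = Σ (Fin (n G) → Fin k) λ c →
                       ∀ {x y} → toℕ x < t → toℕ y < t → Adj G x y → c x ≢ c y

  SeenAt : ∀ {k} → (Fin (n G) → Fin k) → ℕ → Fin (n G) → Fin k → Set
  SeenAt c t v col = ∃[ y ] toℕ y < t × Adj G v y × c y ≡ col

  seenAt? : ∀ {k} (c : Fin (n G) → Fin k) t v col → Dec (SeenAt c t v col)
  seenAt? c t v col = Fin.any? λ y → (toℕ y <? t) ×-dec adj? G v y ×-dec (c y ≟ col)

  -- If every colour occurs on an earlier neighbour of v, one such neighbour per colour forms a star.
  greedy-step : ∀ {k t} (v : Fin (n G)) → toℕ v ≡ t → PrefixColoring k t → PrefixColoring k (suc t) ⊎ Star G k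
  greedy-step {k} {t} v v≡t (c , proper) with Fin.all? (seenAt? c t v)
  ... | yes seen = inj₂ record
    { centre         = v
    ; leaf           = λ col → proj₁ (seen col)
    ; leaf-injective = λ {col} {col′} e → trans (sym (seen-color col)) (trans (cong c e) (seen-color col′))
    ; centre-leaf    = λ col → proj₁ (proj₂ (proj₂ (seen col)))
    }
    where
    seen-color : ∀ col → c (proj₁ (seen col)) ≡ col
    seen-color col = proj₂ (proj₂ (proj₂ (seen col)))
  ... | no not-all with Fin.¬∀⟶∃¬ _ _ (seenAt? c t v) not-all
  ...   | col , unseen = inj₁ (c′ , proper′)
    where
    c′ : Fin (n G) → Fin k
    c′ x with x ≟ v
    ... | yes _ = col
    ... | no  _ = c x
    earlier : ∀ {x} → toℕ x < suc t → x ≢ v → toℕ x < t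
    earlier x<1+t x≢v = ≤∧≢⇒< (≤-pred x<1+t) (λ e → x≢v (Fin.toℕ-injective (trans e (sym v≡t))))
    proper′ : ∀ {x y} → toℕ x < suc t → toℕ y < suc t → Adj G x y → c′ x ≢ c′ y
    proper′ {x} {y} x< y< adj with x ≟ v | y ≟ v
    ... | yes refl | yes refl = contradiction adj (irrefl G)
    ... | yes refl | no  y≢v  = λ e → unseen (y , earlier y< y≢v , adj , sym e)
    ... | no  x≢v  | yes refl = λ e → unseen (x , earlier x< x≢v , adj-sym G adj , e)
    ... | no  x≢v  | no  y≢v  = proper (earlier x< x≢v) (earlier y< y≢v) adj

  greedy : ∀ {k} t → t ≤ n G → PrefixColoring (suc k) t ⊎ Star G (suc k)
  greedy zero    _   = inj₁ ((λ _ → zero) , λ ())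
  greedy (suc t) t<n with greedy t (<⇒≤ t<n)
  ... | inj₁ P = greedy-step (fromℕ< t<n) (Fin.toℕ-fromℕ< t<n) P
  ... | inj₂ S = inj₂ S

  colorable⊎star : ∀ k → Colorable G (suc k) ⊎ Star G (suc k)
  colorable⊎star k with greedy (n G) ≤-refl
  ... | inj₁ (c , proper) = inj₁ (c , λ x y → proper (Fin.toℕ<n x) (Fin.toℕ<n y))
  ... | inj₂ S = inj₂ S

  -- Once the fuel is spent, n G ≤ k and the colouring by vertex index needs only k + 1 colours.
  grow : ∀ fuel {k} → Star G k → n G ≤ k + fuel → ∃[ m ] Star G m × Colorable G (suc m)
  grow zero {k} S n≤k+0 = k , S , colorable-mono {G} n≤1+k (colorable-self G)
    where
    n≤1+k : n G ≤ suc k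
    n≤1+k = ≤-trans n≤k+0 (≤-trans (≤-reflexive (+-identityʳ k)) (n≤1+n k))
  grow (suc fuel) {k} S n≤ with colorable⊎star k
  ... | inj₁ C  = k , S , C
  ... | inj₂ S′ = grow fuel S′ (≤-trans n≤ (≤-reflexive (+-suc k fuel)))

  star×colorable : Fin (n G) → ∃[ m ] Star G m × Colorable G (suc m)
  star×colorable v = grow (n G) noLeaves ≤-refl
    where
    noLeaves : Star G 0
    noLeaves = record { centre = v ; leaf = λ () ; leaf-injective = λ {} ; centre-leaf = λ () }

□-star : ∀ {A B m} → Fin (n A) → Star B m → Star (A □ B) m
□-star {A} {B} x S = record
  { centre         = combine x centre
  ; leaf           = combine x ∘ leaf
  ; leaf-injective = λ {i} {j} e → leaf-injective (Fin.combine-injectiveʳ x (leaf i) x (leaf j) e)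
  ; centre-leaf    = λ i → □-adj {A} {B} (inj₂ (refl , centre-leaf i))
  }
  where open Star S

^□-star : ∀ {F m} e → Star F m → Star (F ^□ suc e) m
^□-star zero    S = S
^□-star (suc e) S = □-star (Star.centre S) (^□-star e S)

-- A clique minor in the product of two stars

module _ {G : Graph} {m} (S : Star G m) where
  open Star S

  data Role : Fin (n G) → Set where
    centreᴿ : Role centre
    leafᴿ   : ∀ i → Role (leaf i)
    otherᴿ  : ∀ {x} → Role x

  role : ∀ x → Role x
  role x with x ≟ centre | Fin.any? (λ i → leaf i ≟ x)
  ... | yes refl | _              = centreᴿ
  ... | no _     | yes (i , refl) = leafᴿ i
  ... | no _     | no _           = otherᴿ

  role-centre : role centre ≡ centreᴿ
  role-centre with centre ≟ centre
  ... | yes refl = refl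
  ... | no c≢c   = contradiction refl c≢c

  role-leaf : ∀ i → role (leaf i) ≡ leafᴿ i
  role-leaf i with leaf i ≟ centre | Fin.any? (λ j → leaf j ≟ leaf i)
  ... | yes e | _ = contradiction e (leaf≢centre i)
  ... | no _  | no none = contradiction (i , refl) none
  ... | no _  | yes (j , e) with leaf-injective e
  role-leaf i | no _ | yes (.i , refl) | refl = refl


_⊔_ : ∀ {m} → Fin m → Fin m → Fin m
i ⊔ j with Fin.<-cmp i j
... | tri< _ _ _ = j
... | tri≈ _ _ _ = i
... | tri> _ _ _ = i

⊔-idem : ∀ {m} (i : Fin m) → i ⊔ i ≡ i
⊔-idem i with Fin.<-cmp i i
... | tri< _ _ _ = refl
... | tri≈ _ _ _ = refl
... | tri> _ _ _ = refl

⊔-greater : ∀ {m} {i j : Fin m} → j Fin.< i → i ⊔ j ≡ i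
⊔-greater {i = i} {j} j<i with Fin.<-cmp i j
... | tri< _ _ j≮i = contradiction j<i j≮i
... | tri≈ _ _ _ = refl
... | tri> _ _ _ = refl

module StarProduct {A B : Graph} {m} (S : Star A m) (T : Star B m) where
  private
    module S = Star S
    module T = Star T

  Vertex : Set
  Vertex = Fin (n A) × Fin (n B)

  branchᴿ : ∀ {x y} → Role S x → Role T y → Maybe (Fin (suc m))
  branchᴿ centreᴿ   centreᴿ   = just zero
  branchᴿ centreᴿ   (leafᴿ j) = just (suc j)
  branchᴿ (leafᴿ i) centreᴿ   = just (suc i)
  branchᴿ (leafᴿ i) (leafᴿ j) = just (suc (i ⊔ j))
  branchᴿ _         _         = nothing

  -- A leaf pair off the diagonal descends through (centre , leaf j) or (leaf i , centre).
  heightᴿ : ∀ {x y} → Role S x → Role T y → ℕ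
  heightᴿ centreᴿ   (leafᴿ _) = 1
  heightᴿ (leafᴿ _) centreᴿ   = 1
  heightᴿ (leafᴿ i) (leafᴿ j) = if ⌊ i ≟ j ⌋ then 0 else 2
  heightᴿ _         _         = 0

  branch : Vertex → Maybe (Fin (suc m))
  branch (x , y) = branchᴿ (role S x) (role T y)

  height : Vertex → ℕ
  height (x , y) = heightᴿ (role S x) (role T y)

  root : Fin (suc m) → Vertex
  root zero    = S.centre , T.centre
  root (suc i) = S.leaf i , T.leaf i

  branch-at : ∀ {x y r s} → role S x ≡ r → role T y ≡ s → branch (x , y) ≡ branchᴿ r s
  branch-at refl refl = refl

  height-at : ∀ {x y r s} → role S x ≡ r → role T y ≡ s → height (x , y) ≡ heightᴿ r s
  height-at refl refl = refl

  branch-root : ∀ i → branch (root i) ≡ just i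
  branch-root zero    = branch-at (role-centre S) (role-centre T)
  branch-root (suc i) = trans (branch-at (role-leaf S i) (role-leaf T i)) (cong (just ∘ suc) (⊔-idem i))

  heightᴿ-diagonal : ∀ i → heightᴿ (leafᴿ {S = S} i) (leafᴿ {S = T} i) ≡ 0
  heightᴿ-diagonal i with i ≟ i
  ... | yes _   = refl
  ... | no  i≢i = contradiction refl i≢i

  heightᴿ-off-diagonal : ∀ {i j} → i ≢ j → 1 < heightᴿ (leafᴿ {S = S} i) (leafᴿ {S = T} j)
  heightᴿ-off-diagonal {i} {j} i≢j with i ≟ j
  ... | yes i≡j = contradiction i≡j i≢j
  ... | no  _   = s≤s (s≤s z≤n)

  height-root : ∀ {h} i → height (root (suc i)) < suc h
  height-root i = subst (_< _) (sym (trans (height-at (role-leaf S i) (role-leaf T i)) (heightᴿ-diagonal i))) (s≤s z≤n)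

  descend : ∀ {z i} → branch z ≡ just i → z ≢ root i →
            ∃[ p ] Adj₂ A B z p × branch p ≡ just i × height p < height z
  descend {x , y} e z≢root with role S x | role T y
  descend refl z≢root | centreᴿ | centreᴿ = contradiction refl z≢root
  descend refl _ | centreᴿ | leafᴿ j =
    root (suc j) , inj₁ (refl , S.centre-leaf j) , branch-root (suc j) , height-root j
  descend refl _ | leafᴿ i | centreᴿ =
    root (suc i) , inj₂ (refl , T.centre-leaf i) , branch-root (suc i) , height-root i
  descend e z≢root | leafᴿ i | leafᴿ j with Fin.<-cmp i j
  descend refl z≢root | leafᴿ i | leafᴿ .i | tri≈ _ refl _ = contradiction refl z≢root
  descend refl _ | leafᴿ i | leafᴿ j | tri< i<j _ _ =
    (S.centre , T.leaf j) , inj₁ (refl , adj-sym A (S.centre-leaf i)) , branch-at (role-centre S) (role-leaf T j) ,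
    subst (_< _) (sym (height-at (role-centre S) (role-leaf T j))) (heightᴿ-off-diagonal (Fin.<⇒≢ i<j))
  descend refl _ | leafᴿ i | leafᴿ j | tri> _ _ j<i =
    (S.leaf i , T.centre) , inj₂ (refl , adj-sym B (T.centre-leaf j)) , branch-at (role-leaf S i) (role-centre T) ,
    subst (_< _) (sym (height-at (role-leaf S i) (role-centre T))) (heightᴿ-off-diagonal (≢-sym (Fin.<⇒≢ j<i)))

  touch : ∀ {i j} → i ≢ j → ∃₂ λ a b → branch a ≡ just i × branch b ≡ just j × Adj₂ A B a b
  touch {zero}  {zero}  i≢j = contradiction refl i≢j
  touch {zero}  {suc j} _   =
    root zero , (S.centre , T.leaf j) , branch-root zero , branch-at (role-centre S) (role-leaf T j) ,
    inj₂ (refl , T.centre-leaf j)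
  touch {suc i} {zero}  _   =
    (S.centre , T.leaf i) , root zero , branch-at (role-centre S) (role-leaf T i) , branch-root zero ,
    inj₂ (refl , adj-sym B (T.centre-leaf i))
  touch {suc i} {suc j} i≢j with Fin.<-cmp i j
  ... | tri≈ _ i≡j _ = contradiction (cong suc i≡j) i≢j
  ... | tri< i<j _ _ =
    (S.centre , T.leaf i) , (S.leaf j , T.leaf i) , branch-at (role-centre S) (role-leaf T i) ,
    trans (branch-at (role-leaf S j) (role-leaf T i)) (cong (just ∘ suc) (⊔-greater i<j)) ,
    inj₁ (refl , S.centre-leaf j)
  ... | tri> _ _ j<i =
    (S.leaf i , T.leaf j) , (S.centre , T.leaf j) ,
    trans (branch-at (role-leaf S i) (role-leaf T j)) (cong (just ∘ suc) (⊔-greater j<i)) ,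
    branch-at (role-centre S) (role-leaf T j) , inj₁ (refl , adj-sym A (S.centre-leaf i))

  cliqueModel : CliqueModel (suc m) (Adj₂ A B)
  cliqueModel = record
    { branch = branch ; root = root ; branch-root = branch-root ; height = height ; descend = descend ; touch = touch }

□-cliqueModel : ∀ {A B m} → Star A m → Star B m → CliqueModel (suc m) (Adj (A □ B))
□-cliqueModel S T = ↔-cliqueModel Fin.*↔× id (StarProduct.cliqueModel S T)

vertex? : (G : Graph) → Dec (Fin (n G))
vertex? G with n G
... | zero  = no λ ()
... | suc _ = yes zero

χ≤η : ∀ {G k c h} → Colorable G k → K k ≼ G → IsChromaticNumber G c → IsHadwigerNumber G h → c ≤ h
χ≤η C minor (_ , χ-least) (_ , η-greatest) = ≤-trans (χ-least _ C) (η-greatest _ minor)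

mainTheorem10 : (F G : Graph) (d : ℕ) → 2 ≤ d → G ≅ (F ^□ d) →
                (c h : ℕ) → IsChromaticNumber G c → IsHadwigerNumber G h → c ≤ h
mainTheorem10 F G (suc (suc e)) _ G≅F^d c h χ η with vertex? F
... | no F-empty = ≤-trans (proj₂ χ 0 (colorable-empty {G} G-empty)) z≤n
  where
  G-empty : ¬ Fin (n G)
  G-empty = F-empty ∘ proj₁ ∘ remQuot _ ∘ Inverse.to (_≅_.bij G≅F^d)
... | yes v with star×colorable F v
...   | m , S , C = χ≤η (colorable-≅ G≅F^d (^□-colorable (suc e) C))
                         (cliqueModel⇒minor (≅-cliqueModel G≅F^d (□-cliqueModel S (^□-star e S)))) χ η
mainTheorem10 F G (suc zero) (s≤s ()) _ _ _ _ _
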